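{- Let $G$ be a structurally saturated labelled sequent. Then the relation $R_G$ on clusters of $G$ is a partial order and the relation $\le_G$ on clusters of $G$ is a preorder. If moreover $G$ is layered, then $\le_G$ on clusters is also a partial order.
   Context: A labelled sequent $G$ is $\mathcal{R},\Gamma\Rightarrow\Delta$ with $\mathcal{R}$ a set of relational atoms $xRy$ or $x\le y$ between labels and $\Gamma,\Delta$ multisets of labelled formulas $x{:}A$; write $x\le_G y$, $xR_Gy$ when the corresponding atom is in $\mathcal{R}$, $x{:}C^\bullet$ when $x{:}C\in\Gamma$. $G$ is structurally saturated iff: $x\le_Gy$ and $x{:}C^\bullet$ imply $y{:}C^\bullet$; $xR_Gy$ and $y\le_Gz$ imply $\exists u$ with $x\le_Gu$, $uR_Gz$; $xR_Gy$ and $x\le_Gz$ imply $\exists u$ with $y\le_Gu$, $zR_Gu$; $\le_G$ and $R_G$ are transitive and reflexive on all labels of $G$. For structurally saturated $G$, a cluster is an equivalence class of $R_G\cap R_G^{ -1}$. On clusters: $C_1\le_G C_2$ iff for every $y\in C_2$ there is $x\in C_1$ with $x\le_G y$; $C_1R_GC_2$ iff there are $x\in C_1$, $y\in C_2$ with $xR_Gy$. A layer of $G$ is an equivalence class of the reflexive transitive closure of $R_G\cup R_G^{ -1}$. $G$ is layered iff for all labels $x,x',y,y'$: (1) if $xR_Gy$ and $x\neq y$ then neither $x\le_Gy$ nor $y\le_Gx$; (2) if $xR_Gy$, $x'R_Gy'$, $x\le_Gx'$ and $x\neq x'$, then not $y'\le_G y$. -}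

module Defs where

open import Data.Nat using (ℕ)
open import Data.Product using (Σ; ∃; ∃-syntax; _×_; _,_; proj₁)
open import Data.List using (List; []; _∷_; _++_; concatMap; map)
open import Data.List.Membership.Propositional using (_∈_)
open import Relation.Binary.PropositionalEquality using (_≡_)
open import Relation.Nullary using (¬_)

Label : Set
Label = ℕ

data RelAtom : Set where
  rAt  : Label → Label → RelAtom
  leAt : Label → Label → RelAtom

-- A labelled sequent  𝓡, Γ ⇒ Δ  over an arbitrary type F of formulas.
-- Γ and Δ are multisets, represented as lists.
record Sequent (F : Set) : Set where
  constructor seq
  field
    rel  : List RelAtom
    ante : List (Label × F)
    succ : List (Label × F)
open Sequent public

module _ {F : Set} (G : Sequent F) where

  RG : Label → Label → Set
  RG x y = rAt x y ∈ rel G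

  LeG : Label → Label → Set
  LeG x y = leAt x y ∈ rel G

  InAnte : Label → F → Set
  InAnte x C = (x , C) ∈ ante G

  atomLabels : RelAtom → List Label
  atomLabels (rAt x y)  = x ∷ y ∷ []
  atomLabels (leAt x y) = x ∷ y ∷ []

  labels : List Label
  labels = concatMap atomLabels (rel G) ++ map proj₁ (ante G) ++ map proj₁ (succ G)

  IsLabel : Label → Set
  IsLabel x = x ∈ labels

record StructurallySaturated {F : Set} (G : Sequent F) : Set where
  field
    mono    : ∀ x y C → LeG G x y → InAnte G x C → InAnte G y C
    F1      : ∀ x y z → RG G x y → LeG G y z → ∃[ u ] (LeG G x u × RG G u z)
    F2      : ∀ x y z → RG G x y → LeG G x z → ∃[ u ] (LeG G y u × RG G z u)
    ≤-trans : ∀ x y z → LeG G x y → LeG G y z → LeG G x z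
    R-trans : ∀ x y z → RG G x y → RG G y z → RG G x z
    ≤-refl  : ∀ x → IsLabel G x → LeG G x x
    R-refl  : ∀ x → IsLabel G x → RG G x x

record Layered {F : Set} (G : Sequent F) : Set where
  field
    lay1 : ∀ x y → RG G x y → ¬ (x ≡ y) → ¬ LeG G x y × ¬ LeG G y x
    lay2 : ∀ x x' y y' → RG G x y → RG G x' y' → LeG G x x' → ¬ (x ≡ x') → ¬ LeG G y' y

-- Clusters: equivalence classes of R_G ∩ R_G⁻¹ on the labels of G.
-- Since Agda has no quotients, a cluster is given by a representative
-- label of G, and clusters are compared by the equivalence _≈C_.
module _ {F : Set} (G : Sequent F) where

  Cluster : Set
  Cluster = Σ Label (IsLabel G)

  _∈C_ : Label → Cluster → Set
  y ∈C (c , _) = IsLabel G y × RG G c y × RG G y c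

  _≈C_ : Cluster → Cluster → Set
  (c , _) ≈C (d , _) = RG G c d × RG G d c

  _≤C_ : Cluster → Cluster → Set
  C₁ ≤C C₂ = ∀ y → y ∈C C₂ → ∃[ x ] (x ∈C C₁ × LeG G x y)

  _RC_ : Cluster → Cluster → Set
  C₁ RC C₂ = ∃[ x ] ∃[ y ] (x ∈C C₁ × y ∈C C₂ × RG G x y)

{-# OPTIONS --safe #-}
module Submission where

open import Defs
open import Data.Product using (_×_; _,_; proj₁)
open import Data.Nat using (_≟_)
open import Data.Empty using (⊥-elim)
open import Relation.Nullary using (yes; no)
open import Relation.Binary.PropositionalEquality using (_≡_; refl)
open import Relation.Binary.Structures using (IsPartialOrder; IsPreorder; IsEquivalence)

-- Clusters are the classes of the preorder R_G, so R_G on clusters is the partial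
-- order it induces, and ≤_G on clusters inherits reflexivity and transitivity from
-- labels. For antisymmetry of ≤_G, pick d ∈ D, then x ∈ C with x ≤ d and d' ∈ D with
-- d' ≤ x. Layering forbids ≤ between distinct R-related labels, so d' = d, and it
-- makes ≤ antisymmetric on labels, so x = d; hence C and D share the label d.

module _ {F : Set} {G : Sequent F} (L : Layered G) where
  open Layered L

  R-≤⇒≡ : ∀ {x y} → RG G x y → LeG G x y → x ≡ y
  R-≤⇒≡ {x} {y} xRy x≤y with x ≟ y
  ... | yes x≡y = x≡y
  ... | no x≢y  = ⊥-elim (proj₁ (lay1 x y xRy x≢y) x≤y)

  ≤-antisym : ∀ {x y} → RG G x x → RG G y y → LeG G x y → LeG G y x → x ≡ y
  ≤-antisym {x} {y} xRx yRy x≤y y≤x with x ≟ y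
  ... | yes x≡y = x≡y
  ... | no x≢y  = ⊥-elim (lay2 x y x y xRx yRy x≤y x≢y y≤x)

module _ {F : Set} {G : Sequent F} (S : StructurallySaturated G) where
  open StructurallySaturated S

  private
    _∈ᶜ_ = _∈C_ G
    _≈ᶜ_ = _≈C_ G
    _≤ᶜ_ = _≤C_ G
    _Rᶜ_ = _RC_ G
    R-trans₃ : ∀ {x y z w} → RG G x y → RG G y z → RG G z w → RG G x w
    R-trans₃ xRy yRz zRw = R-trans _ _ _ xRy (R-trans _ _ _ yRz zRw)

  rep∈C : (C : Cluster G) → proj₁ C ∈ᶜ C
  rep∈C (c , c∈G) = c∈G , R-refl c c∈G , R-refl c c∈G

  ∈C-R : ∀ {x y} (C : Cluster G) → x ∈ᶜ C → y ∈ᶜ C → RG G x y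
  ∈C-R C (_ , _ , xRc) (_ , cRy , _) = R-trans _ _ _ xRc cRy

  ∈C-resp-≈ : ∀ {x} {C D : Cluster G} → C ≈ᶜ D → x ∈ᶜ C → x ∈ᶜ D
  ∈C-resp-≈ (cRd , dRc) (x∈G , cRx , xRc) = x∈G , R-trans _ _ _ dRc cRx , R-trans _ _ _ xRc cRd

  ≈C-isEquivalence : IsEquivalence _≈ᶜ_
  ≈C-isEquivalence = record
    { refl  = λ {C} → let (_ , cRc , _) = rep∈C C in cRc , cRc
    ; sym   = λ (cRd , dRc) → dRc , cRd
    ; trans = λ (cRd , dRc) (dRe , eRd) → R-trans _ _ _ cRd dRe , R-trans _ _ _ eRd dRc
    }

  RC-isPartialOrder : IsPartialOrder _≈ᶜ_ _Rᶜ_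
  RC-isPartialOrder = record
    { isPreorder = record
      { isEquivalence = ≈C-isEquivalence
      ; reflexive     = λ {C} {D} (cRd , _) → _ , _ , rep∈C C , rep∈C D , cRd
      ; trans         = λ {C} {D} {E} (x , y , x∈C , y∈D , xRy) (y' , z , y'∈D , z∈E , y'Rz) →
                          x , z , x∈C , z∈E , R-trans₃ xRy (∈C-R D y∈D y'∈D) y'Rz
      }
    ; antisym = λ {C} {D} (x , y , x∈C , y∈D , xRy) (y' , x' , y'∈D , x'∈C , y'Rx') →
        R-trans₃ (∈C-R C (rep∈C C) x∈C) xRy (∈C-R D y∈D (rep∈C D)) ,
        R-trans₃ (∈C-R D (rep∈C D) y'∈D) y'Rx' (∈C-R C x'∈C (rep∈C C))
    }

  ≤C-isPreorder : IsPreorder _≈ᶜ_ _≤ᶜ_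
  ≤C-isPreorder = record
    { isEquivalence = ≈C-isEquivalence
    ; reflexive     = λ {C} {D} (cRd , dRc) y y∈D →
        y , ∈C-resp-≈ {C = D} {D = C} (dRc , cRd) y∈D , ≤-refl y (proj₁ y∈D)
    ; trans         = λ C≤D D≤E z z∈E →
        let (y , y∈D , y≤z) = D≤E z z∈E
            (x , x∈C , x≤y) = C≤D y y∈D
        in x , x∈C , ≤-trans _ _ _ x≤y y≤z
    }

  ≤C-antisym : Layered G → ∀ {C D : Cluster G} → C ≤ᶜ D → D ≤ᶜ C → C ≈ᶜ D
  ≤C-antisym L {D = D@(d , d∈G)} C≤D D≤C with C≤D d (rep∈C D)
  ... | x , x∈C@(x∈G , cRx , xRc) , x≤d with D≤C x x∈C
  ... | d' , d'∈D , d'≤x with R-≤⇒≡ L (∈C-R D d'∈D (rep∈C D)) (≤-trans _ _ _ d'≤x x≤d)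
  ... | refl with ≤-antisym L (R-refl x x∈G) (R-refl d d∈G) x≤d d'≤x
  ... | refl = cRx , xRc

  ≤C-isPartialOrder : Layered G → IsPartialOrder _≈ᶜ_ _≤ᶜ_
  ≤C-isPartialOrder L = record
    { isPreorder = ≤C-isPreorder
    ; antisym    = λ {C} {D} → ≤C-antisym L {C} {D}
    }

mainTheorem4 : {F : Set} (G : Sequent F) → StructurallySaturated G →
    IsPartialOrder (_≈C_ G) (_RC_ G)
    × IsPreorder (_≈C_ G) (_≤C_ G)
    × (Layered G → IsPartialOrder (_≈C_ G) (_≤C_ G))
mainTheorem4 G S =
    RC-isPartialOrder S
  , ≤C-isPreorder S
  , ≤C-isPartialOrder S
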